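{- Let $\Gamma$ be a finite, simple, strongly connected digraph of order $n\geq 2$ with diameter $d$. Then $f(n,d)\leq \dim(\Gamma)\leq n-d$, where $f(n,d)$ is the least positive integer $k$ for which $k+d^{2k}\geq n$.
   Context: $\partial(x,y)$ is the length of a shortest directed path from $x$ to $y$; $\tilde\partial(x,y)=(\partial(x,y),\partial(y,x))$; the diameter is $\max_{x,y}\partial(x,y)$. A subset $\{w_1,\dots,w_m\}\subseteq V(\Gamma)$ is a weakly resolving set if $(\tilde\partial(w_1,u),\dots,\tilde\partial(w_m,u))\neq(\tilde\partial(w_1,v),\dots,\tilde\partial(w_m,v))$ for all distinct $u,v\in V(\Gamma)$; $\dim(\Gamma)$, the weak metric dimension, is the minimum cardinality of a weakly resolving set. Simple means no loops and at most one arc for each ordered pair of vertices. -}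

module Defs where

open import Data.Nat using (ℕ; zero; suc; _+_; _*_; _∸_; _^_; _≤_; _<_)
open import Data.Fin using (Fin)
open import Data.Fin.Subset using (Subset; _∈_; ∣_∣)
open import Data.Bool using (Bool; true; false; T)
open import Data.Product using (_×_; ∃; ∃-syntax; Σ-syntax)
open import Relation.Binary.PropositionalEquality using (_≡_; _≢_)
open import Relation.Nullary using (¬_)

-- A finite simple digraph on vertex set Fin n: adjacency (arc x → y) as a
-- Bool-valued relation, so at most one arc per ordered pair; no loops.
record Digraph (n : ℕ) : Set where
  field
    arc    : Fin n → Fin n → Bool
    noLoop : ∀ x → arc x x ≡ false
open Digraph public

data Walk {n : ℕ} (G : Digraph n) : Fin n → Fin n → ℕ → Set where
  here : ∀ {x} → Walk G x x 0
  step : ∀ {x y z k} → T (arc G x y) → Walk G y z k → Walk G x z (suc k)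

-- m is the length of a shortest directed path from x to y.
-- (A shortest directed walk is a path, so this is ∂(x,y) = m.)
IsDist : ∀ {n} → Digraph n → Fin n → Fin n → ℕ → Set
IsDist G x y m = Walk G x y m × (∀ k → k < m → ¬ Walk G x y k)

StronglyConnected : ∀ {n} → Digraph n → Set
StronglyConnected G = ∀ x y → ∃[ m ] Walk G x y m

IsDistFun : ∀ {n} → Digraph n → (Fin n → Fin n → ℕ) → Set
IsDistFun G ∂ = ∀ x y → IsDist G x y (∂ x y)

IsDiameter : ∀ {n} → (Fin n → Fin n → ℕ) → ℕ → Set
IsDiameter ∂ d = (∀ x y → ∂ x y ≤ d) × (∃[ x ] ∃[ y ] ∂ x y ≡ d)

-- W is weakly resolving: for distinct u, v the vectors
-- (∂̃(w,u))_{w∈W} and (∂̃(w,v))_{w∈W} differ, where ∂̃(x,y) = (∂(x,y), ∂(y,x)).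
WeaklyResolving : ∀ {n} → (Fin n → Fin n → ℕ) → Subset n → Set
WeaklyResolving ∂ W =
  ∀ u v → u ≢ v →
    ¬ (∀ w → w ∈ W → (∂ w u ≡ ∂ w v) × (∂ u w ≡ ∂ v w))

IsWeakMetricDim : ∀ {n} → (Fin n → Fin n → ℕ) → ℕ → Set
IsWeakMetricDim ∂ k =
  (∃[ W ] (WeaklyResolving ∂ W × ∣ W ∣ ≡ k))
  × (∀ W → WeaklyResolving ∂ W → k ≤ ∣ W ∣)

IsF : ℕ → ℕ → ℕ → Set
IsF n d k =
  1 ≤ k × n ≤ k + d ^ (2 * k)
  × (∀ j → 1 ≤ j → j < k → j + d ^ (2 * j) < n)

-- A weakly resolving set W separates the vertices outside W by their profiles
-- (∂̃(w,u))_{w∈W}, and for u ∉ W every entry of the profile lies in {1,…,d}².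
-- Hence n − |W| ≤ d^(2|W|), and f(n,d) ≤ |W| by minimality of f(n,d).
-- Conversely, let x = c₀, c₁, …, c_d = y be a geodesic with ∂(x,y) = d. Each cᵢ
-- is at distance i from x, so the vertices c₁, …, c_d are distinguished by
-- their distance from x alone; therefore the complement of {c₁, …, c_d}, which
-- contains x, is weakly resolving and has n − d elements.
module Submission where

open import Defs
open import Data.Nat using (ℕ; _≤_; _∸_)
open import Data.Fin using (Fin)
open import Data.Product using (_×_)

open import Function using (_∘_)
open import Data.Nat using (zero; suc; _+_; _*_; _^_; _<_; z≤n; s≤s)
open import Data.Nat.Properties
open import Data.Fin using (zero; suc)
import Data.Fin.Properties as Fin
open import Data.Fin.Subset using (Subset; _∈_; _∉_; ∣_∣; ⊥; ⁅_⁆; _∪_; ∁)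
open import Data.Fin.Subset.Properties
  using (_∈?_; ∉⊥; ∣⊥∣≡0; ∪-identityˡ; x∈⁅y⁆⇒x≡y; x∈p∪q⁻; ∣∁p∣≡n∸∣p∣; x∈∁p⇒x∉p; x∉∁p⇒x∈p; x∉p⇒x∈∁p)
open import Data.Bool using (true; false)
open import Data.Vec using ([]; _∷_; here; there)
open import Data.List using (List; length; applyUpTo; cartesianProduct; cartesianProductWith)
import Data.List as List
open import Data.List.Properties using (length-++; length-map; length-applyUpTo; length-removeAt′; ∷-injectiveˡ; ∷-injectiveʳ)
open import Data.List.Relation.Unary.All using (All)
import Data.List.Relation.Unary.All as All
open import Data.List.Relation.Unary.Any using (index; _─_)
import Data.List.Relation.Unary.Any as Any
open import Data.List.Membership.Propositional using () renaming (_∈_ to _∈ₗ_)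
open import Data.List.Membership.Propositional.Properties
  using (∈-cartesianProductWith⁺; ∈-cartesianProduct⁺; ∈-applyUpTo⁺)
open import Data.Product using (∃-syntax; _,_; proj₁; proj₂)
open import Data.Product.Properties using (,-injective)
open import Data.Sum using (inj₁; inj₂)
open import Data.Empty using (⊥-elim)
open import Relation.Nullary using (yes; no)
open import Relation.Binary.PropositionalEquality

module _ {A : Set} where

  ∈-─ : ∀ {x y : A} {xs} (x∈xs : x ∈ₗ xs) → y ∈ₗ xs → y ≢ x → y ∈ₗ (xs ─ x∈xs)
  ∈-─ (Any.here refl)  (Any.here refl)  y≢x = ⊥-elim (y≢x refl)
  ∈-─ (Any.here refl)  (Any.there y∈xs) _   = y∈xs
  ∈-─ (Any.there _)    (Any.here refl)  _   = Any.here refl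
  ∈-─ (Any.there x∈xs) (Any.there y∈xs) y≢x = Any.there (∈-─ x∈xs y∈xs y≢x)

  length-cartesianProductWith : ∀ {B C : Set} (f : A → B → C) xs ys →
    length (cartesianProductWith f xs ys) ≡ length xs * length ys
  length-cartesianProductWith f List.[] ys = refl
  length-cartesianProductWith f (x List.∷ xs) ys = begin
    length (List.map (f x) ys List.++ cartesianProductWith f xs ys)
      ≡⟨ length-++ (List.map (f x) ys) ⟩
    length (List.map (f x) ys) + length (cartesianProductWith f xs ys)
      ≡⟨ cong₂ _+_ (length-map (f x) ys) (length-cartesianProductWith f xs ys) ⟩
    length ys + length xs * length ys ∎
    where open ≡-Reasoning

  words : ℕ → List A → List (List A)
  words zero    as = List.[ List.[] ]
  words (suc k) as = cartesianProductWith List._∷_ as (words k as)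

  length-words : ∀ k as → length (words k as) ≡ length as ^ k
  length-words zero    as = refl
  length-words (suc k) as =
    trans (length-cartesianProductWith List._∷_ as (words k as))
          (cong (length as *_) (length-words k as))

  ∈-words : ∀ {as ws} → All (_∈ₗ as) ws → ws ∈ₗ words (length ws) as
  ∈-words All.[]           = Any.here refl
  ∈-words (a∈as All.∷ all) = ∈-cartesianProductWith⁺ List._∷_ a∈as (∈-words all)

  select : ∀ {n} → Subset n → (Fin n → A) → List A
  select []          f = List.[]
  select (true ∷ p)  f = f zero List.∷ select p (f ∘ suc)
  select (false ∷ p) f = select p (f ∘ suc)

  length-select : ∀ {n} (p : Subset n) f → length (select p f) ≡ ∣ p ∣
  length-select []          f = refl
  length-select (true ∷ p)  f = cong suc (length-select p (f ∘ suc))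
  length-select (false ∷ p) f = length-select p (f ∘ suc)

  All-select : ∀ {n} {P : A → Set} (p : Subset n) {f} →
               (∀ {w} → w ∈ p → P (f w)) → All P (select p f)
  All-select []          Pf = All.[]
  All-select (true ∷ p)  Pf = Pf here All.∷ All-select p (Pf ∘ there)
  All-select (false ∷ p) Pf = All-select p (Pf ∘ there)

  select-≡⁻ : ∀ {n} (p : Subset n) {f g} → select p f ≡ select p g →
              ∀ {w} → w ∈ p → f w ≡ g w
  select-≡⁻ (true ∷ p)  eq here        = ∷-injectiveˡ eq
  select-≡⁻ (true ∷ p)  eq (there w∈p) = select-≡⁻ p (∷-injectiveʳ eq) w∈p
  select-≡⁻ (false ∷ p) eq (there w∈p) = select-≡⁻ p eq w∈p

∣p∣≤length : ∀ {n} {B : Set} (p : Subset n) (g : Fin n → B) {ys : List B} →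
             (∀ {u v} → u ∈ p → v ∈ p → g u ≡ g v → u ≡ v) →
             (∀ {u} → u ∈ p → g u ∈ₗ ys) → ∣ p ∣ ≤ length ys
∣p∣≤length []          g inj into = z≤n
∣p∣≤length (false ∷ p) g inj into =
  ∣p∣≤length p (g ∘ suc) (λ u∈p v∈p → Fin.suc-injective ∘ inj (there u∈p) (there v∈p))
                         (into ∘ there)
∣p∣≤length (true ∷ p)  g {ys} inj into = begin
  suc ∣ p ∣                  ≤⟨ s≤s (∣p∣≤length p (g ∘ suc) inj′ into′) ⟩
  suc (length (ys ─ g0∈ys)) ≡⟨ length-removeAt′ ys (index g0∈ys) ⟨
  length ys                  ∎
  where
  open ≤-Reasoning
  g0∈ys : g zero ∈ₗ ys
  g0∈ys = into here
  inj′ : ∀ {u v} → u ∈ p → v ∈ p → g (suc u) ≡ g (suc v) → u ≡ v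
  inj′ u∈p v∈p = Fin.suc-injective ∘ inj (there u∈p) (there v∈p)
  into′ : ∀ {u} → u ∈ p → g (suc u) ∈ₗ (ys ─ g0∈ys)
  into′ u∈p = ∈-─ g0∈ys (into (there u∈p)) (λ eq → Fin.0≢1+n (sym (inj (there u∈p) here eq)))

∣⁅x⁆∪p∣≡1+∣p∣ : ∀ {n} (x : Fin n) (p : Subset n) → x ∉ p → ∣ ⁅ x ⁆ ∪ p ∣ ≡ suc ∣ p ∣
∣⁅x⁆∪p∣≡1+∣p∣ zero    (true ∷ p)  x∉p = ⊥-elim (x∉p here)
∣⁅x⁆∪p∣≡1+∣p∣ zero    (false ∷ p) x∉p = cong (suc ∘ ∣_∣) (∪-identityˡ p)
∣⁅x⁆∪p∣≡1+∣p∣ (suc x) (true ∷ p)  x∉p = cong suc (∣⁅x⁆∪p∣≡1+∣p∣ x p (x∉p ∘ there))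
∣⁅x⁆∪p∣≡1+∣p∣ (suc x) (false ∷ p) x∉p = ∣⁅x⁆∪p∣≡1+∣p∣ x p (x∉p ∘ there)

imageBelow : ∀ {n} → (ℕ → Fin n) → ℕ → Subset n
imageBelow f zero    = ⊥
imageBelow f (suc j) = ⁅ f j ⁆ ∪ imageBelow f j

∈imageBelow⁻ : ∀ {n} (f : ℕ → Fin n) j {v} → v ∈ imageBelow f j → ∃[ i ] i < j × v ≡ f i
∈imageBelow⁻ f zero    v∈ = ⊥-elim (∉⊥ v∈)
∈imageBelow⁻ f (suc j) v∈ with x∈p∪q⁻ ⁅ f j ⁆ (imageBelow f j) v∈
... | inj₁ v∈⁅fj⁆ = j , n<1+n j , x∈⁅y⁆⇒x≡y (f j) v∈⁅fj⁆
... | inj₂ v∈img with ∈imageBelow⁻ f j v∈img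
...   | i , i<j , v≡fi = i , m<n⇒m<1+n i<j , v≡fi

∣imageBelow∣ : ∀ {n} (f : ℕ → Fin n) j →
               (∀ {i i′} → i < j → i′ < j → f i ≡ f i′ → i ≡ i′) → ∣ imageBelow f j ∣ ≡ j
∣imageBelow∣ {n} f zero    inj = ∣⊥∣≡0 n
∣imageBelow∣     f (suc j) inj =
  trans (∣⁅x⁆∪p∣≡1+∣p∣ (f j) (imageBelow f j) fj∉)
        (cong suc (∣imageBelow∣ f j (λ i<j i′<j → inj (m<n⇒m<1+n i<j) (m<n⇒m<1+n i′<j))))
  where
  fj∉ : f j ∉ imageBelow f j
  fj∉ fj∈ with ∈imageBelow⁻ f j fj∈
  ... | i , i<j , fj≡fi = <-irrefl (sym (inj (n<1+n j) (m<n⇒m<1+n i<j) fj≡fi)) i<j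

IsF-least : ∀ {n d f k} → 2 ≤ n → IsF n d f → n ≤ k + d ^ (2 * k) → f ≤ k
IsF-least {k = zero}  2≤n _ n≤1 = ⊥-elim (≤⇒≯ n≤1 2≤n)
IsF-least {k = suc k} 2≤n (_ , _ , least) n≤ with _ ≤? suc k
... | yes f≤k = f≤k
... | no  f≰k = ⊥-elim (≤⇒≯ n≤ (least (suc k) (s≤s z≤n) (≰⇒> f≰k)))

module _ {n} {G : Digraph n} where

  _++ʷ_ : ∀ {x y z a b} → Walk G x y a → Walk G y z b → Walk G x z (a + b)
  here       ++ʷ q = q
  step e p   ++ʷ q = step e (p ++ʷ q)

  vertexAt : ∀ {x y m} → Walk G x y m → ℕ → Fin n
  vertexAt {x} here       i       = x
  vertexAt {x} (step e w) zero    = x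
  vertexAt     (step e w) (suc i) = vertexAt w i

  splitAt : ∀ {x y m} (w : Walk G x y m) {i} → i ≤ m →
            Walk G x (vertexAt w i) i × Walk G (vertexAt w i) y (m ∸ i)
  splitAt here       z≤n      = here , here
  splitAt (step e w) {zero} _ = here , step e w
  splitAt (step e w) {suc i} (s≤s i≤m) =
    let prefix , suffix = splitAt w i≤m in step e prefix , suffix

module Distance {n} (G : Digraph n) (∂ : Fin n → Fin n → ℕ) (isDist : IsDistFun G ∂) where

  shortest : ∀ x y → Walk G x y (∂ x y)
  shortest x y = proj₁ (isDist x y)

  ∂-minimal : ∀ {x y k} → Walk G x y k → ∂ x y ≤ k
  ∂-minimal {x} {y} {k} w = ≮⇒≥ (λ k<∂ → proj₂ (isDist x y) k k<∂ w)

  ∂-refl : ∀ x → ∂ x x ≡ 0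
  ∂-refl x = n≤0⇒n≡0 (∂-minimal here)

  ∂≡0⇒≡ : ∀ {x y} → ∂ x y ≡ 0 → x ≡ y
  ∂≡0⇒≡ {x} {y} ∂≡0 with subst (Walk G x y) ∂≡0 (shortest x y)
  ... | here = refl

  ∂-positive : ∀ {x y} → x ≢ y → 0 < ∂ x y
  ∂-positive x≢y = n≢0⇒n>0 (x≢y ∘ ∂≡0⇒≡)

  ∂-vertexAt-geodesic : ∀ {x y i} (w : Walk G x y (∂ x y)) → i ≤ ∂ x y →
                        ∂ x (vertexAt w i) ≡ i
  ∂-vertexAt-geodesic {x} {y} {i} w i≤m =
    ≤-antisym (∂-minimal prefix) (begin
      i                  ≡⟨ m∸[m∸n]≡n i≤m ⟨
      m ∸ (m ∸ i)        ≤⟨ ∸-monoˡ-≤ (m ∸ i) (∂-minimal (shortest x v ++ʷ suffix)) ⟩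
      ∂ x v + (m ∸ i) ∸ (m ∸ i) ≡⟨ m+n∸n≡m (∂ x v) (m ∸ i) ⟩
      ∂ x v              ∎)
    where
    open ≤-Reasoning
    m : ℕ
    m = ∂ x y
    v : Fin n
    v = vertexAt w i
    prefix : Walk G x v i
    prefix = proj₁ (splitAt w i≤m)
    suffix : Walk G v y (m ∸ i)
    suffix = proj₂ (splitAt w i≤m)

  resolving-by-source : ∀ {x W} → x ∈ W →
                        (∀ {u v} → u ∉ W → v ∉ W → ∂ x u ≡ ∂ x v → u ≡ v) →
                        WeaklyResolving ∂ W
  resolving-by-source {x} {W} x∈W inj u v u≢v agree with u ∈? W | v ∈? W
  ... | yes u∈W | _       = u≢v (∂≡0⇒≡ (trans (sym (proj₁ (agree u u∈W))) (∂-refl u)))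
  ... | no _    | yes v∈W = u≢v (sym (∂≡0⇒≡ (trans (proj₁ (agree v v∈W)) (∂-refl v))))
  ... | no u∉W  | no v∉W  = u≢v (inj u∉W v∉W (proj₁ (agree x x∈W)))

  resolving-of-size-n∸∂ : ∀ x y → ∃[ W ] WeaklyResolving ∂ W × ∣ W ∣ ≡ n ∸ ∂ x y
  resolving-of-size-n∸∂ x y =
    ∁ P , resolving-by-source (x∉p⇒x∈∁p x∉P) separated ,
    trans (∣∁p∣≡n∸∣p∣ P) (cong (n ∸_) (∣imageBelow∣ c (∂ x y) c-injective))
    where
    c : ℕ → Fin n
    c i = vertexAt (shortest x y) (suc i)

    ∂-c : ∀ {i} → i < ∂ x y → ∂ x (c i) ≡ suc i
    ∂-c = ∂-vertexAt-geodesic (shortest x y)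

    c-injective : ∀ {i i′} → i < ∂ x y → i′ < ∂ x y → c i ≡ c i′ → i ≡ i′
    c-injective i< i′< ci≡ci′ = suc-injective (trans (sym (∂-c i<)) (trans (cong (∂ x) ci≡ci′) (∂-c i′<)))

    P : Subset n
    P = imageBelow c (∂ x y)

    x∉P : x ∉ P
    x∉P x∈P with ∈imageBelow⁻ c (∂ x y) x∈P
    ... | i , i< , x≡ci = 0≢1+n (trans (sym (∂-refl x)) (trans (cong (∂ x) x≡ci) (∂-c i<)))

    separated : ∀ {u v} → u ∉ ∁ P → v ∉ ∁ P → ∂ x u ≡ ∂ x v → u ≡ v
    separated u∉ v∉ ∂u≡∂v
      with ∈imageBelow⁻ c (∂ x y) (x∉∁p⇒x∈p u∉) | ∈imageBelow⁻ c (∂ x y) (x∉∁p⇒x∈p v∉)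
    ... | i , i< , refl | i′ , i′< , refl =
      cong c (suc-injective (trans (sym (∂-c i<)) (trans ∂u≡∂v (∂-c i′<))))

  ∂̃ : Fin n → Fin n → ℕ × ℕ
  ∂̃ w u = ∂ w u , ∂ u w

  profile : Subset n → Fin n → List (ℕ × ℕ)
  profile W u = select W (λ w → ∂̃ w u)

  n≤∣W∣+d^[2∣W∣] : ∀ {d W} → (∀ x y → ∂ x y ≤ d) → WeaklyResolving ∂ W →
                   n ≤ ∣ W ∣ + d ^ (2 * ∣ W ∣)
  n≤∣W∣+d^[2∣W∣] {d} {W} bounded resolving = begin
    n                                      ≤⟨ m≤n+m∸n n k ⟩
    k + (n ∸ k)                            ≡⟨ cong (k +_) (∣∁p∣≡n∸∣p∣ W) ⟨
    k + ∣ ∁ W ∣                            ≤⟨ +-monoʳ-≤ k (∣p∣≤length (∁ W) (profile W) profile-injective profile∈words) ⟩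
    k + length (words k pairs)             ≡⟨ cong (k +_) count ⟩
    k + d ^ (2 * k)                        ∎
    where
    open ≤-Reasoning
    k : ℕ
    k = ∣ W ∣
    distances : List ℕ
    distances = applyUpTo suc d
    pairs : List (ℕ × ℕ)
    pairs = cartesianProduct distances distances

    count : length (words k pairs) ≡ d ^ (2 * k)
    count = begin-equality
      length (words k pairs) ≡⟨ length-words k pairs ⟩
      length pairs ^ k       ≡⟨ cong (_^ k) (length-cartesianProductWith _,_ distances distances) ⟩
      (length distances * length distances) ^ k
                             ≡⟨ cong (λ m → (m * m) ^ k) (length-applyUpTo suc d) ⟩
      (d * d) ^ k            ≡⟨ cong (λ m → (d * m) ^ k) (*-identityʳ d) ⟨
      (d ^ 2) ^ k            ≡⟨ ^-*-assoc d 2 k ⟩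
      d ^ (2 * k)            ∎

    ∈-distances : ∀ {z} → 0 < z → z ≤ d → z ∈ₗ distances
    ∈-distances {suc z} _ z<d = ∈-applyUpTo⁺ suc z<d

    profile-injective : ∀ {u v} → u ∈ ∁ W → v ∈ ∁ W → profile W u ≡ profile W v → u ≡ v
    profile-injective {u} {v} _ _ same with u Fin.≟ v
    ... | yes u≡v = u≡v
    ... | no  u≢v = ⊥-elim (resolving u v u≢v (λ w w∈W → ,-injective (select-≡⁻ W same w∈W)))

    profile∈words : ∀ {u} → u ∈ ∁ W → profile W u ∈ₗ words k pairs
    profile∈words {u} u∈∁W =
      subst (λ m → profile W u ∈ₗ words m pairs) (length-select W (λ w → ∂̃ w u))
            (∈-words (All-select W λ {w} w∈W →
              let w≢u = λ w≡u → x∈∁p⇒x∉p u∈∁W (subst (_∈ W) w≡u w∈W) in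
              ∈-cartesianProduct⁺ (∈-distances (∂-positive w≢u) (bounded w u))
                                  (∈-distances (∂-positive (w≢u ∘ sym)) (bounded u w))))

theorem2p1 : ∀ (n : ℕ) → 2 ≤ n → (G : Digraph n) → StronglyConnected G →
             (∂ : Fin n → Fin n → ℕ) → IsDistFun G ∂ →
             (d : ℕ) → IsDiameter ∂ d →
             (fnd : ℕ) → IsF n d fnd →
             (k : ℕ) → IsWeakMetricDim ∂ k →
             fnd ≤ k × k ≤ n ∸ d
theorem2p1 n 2≤n G _ ∂ isDist d (bounded , x , y , ∂xy≡d) fnd isF k ((W , resolving , ∣W∣≡k) , minimal) =
  let open Distance G ∂ isDist
      (W′ , resolving′ , ∣W′∣≡n∸∂xy) = resolving-of-size-n∸∂ x y
  in IsF-least 2≤n isF (subst (λ m → n ≤ m + d ^ (2 * m)) ∣W∣≡k (n≤∣W∣+d^[2∣W∣] bounded resolving)) ,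
     subst (k ≤_) (trans ∣W′∣≡n∸∂xy (cong (n ∸_) ∂xy≡d)) (minimal W′ resolving′)
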